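{- Let $\mathcal T$ be a tower diagram. (a) If $\alpha$ is a positive integer such that the slide $\alpha^{\searrow}\mathcal T$ does not terminate, so that $\alpha^{\searrow}\mathcal T=\mathcal T\cup\{d\}$ for a cell $d\notin\mathcal T$, then $d$ is a corner cell of $\alpha^{\searrow}\mathcal T$ and the flight number of $d$ in $\alpha^{\searrow}\mathcal T$ equals $\alpha$. (b) If $c$ is a corner cell of $\mathcal T$ with flight number $\beta$ in $\mathcal T$, then $\beta^{\searrow}(\mathcal T\setminus\{c\})=\mathcal T$.
   Context: A cell is a pair $(i,j)$ of integers with $i\ge 1$, $j\ge 0$. A tower diagram is a finite set $\mathcal T$ of cells such that $(i,j)\in\mathcal T$ and $0\le k\le j$ imply $(i,k)\in\mathcal T$; its $i$-th tower is $\mathcal T_i=\{(i,j)\in\mathcal T\}$. The cell $(i,j)$ lies on the diagonal $x+y=i+j$. Flight paths (recursive definition): a cell $(i,j)\in\mathcal T$ has a flight path in $\mathcal T$ if either (F1) there is no cell $(i',j')\in\mathcal T$ with $i'<i$ and $i'+j'=i+j-1$, in which case its flight path is $\{(i,j)\}$; or (F2) such cells exist and, letting $(i',j')$ be the one with largest $i'$, the cell $(i',j')$ has a flight path and $(i',j'+1)\in\mathcal T$, in which case the flight path of $(i,j)$ is $\{(i,j),(i',j'+1)\}\cup\mathrm{flightpath}((i',j'),\mathcal T)$. The flight number of a cell with a flight path is $a+b$ where $(a,b)$ is the lexicographically smallest element of its flight path. A corner cell of $\mathcal T$ is a cell $(i,j)\in\mathcal T$ with $(i,j+1)\notin\mathcal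 T$ that has a flight path in $\mathcal T$. Sliding: for a positive integer $\alpha$, the slide $\alpha^{\searrow}\mathcal T$ is computed by the procedure $P(\gamma,m)$ started at $\gamma=\alpha$, $m=1$: (S1) if no cell $(i,j)\in\mathcal T$ with $i\ge m$ lies on the diagonal $x+y=\gamma-1$, then: (a) if $(\gamma,0)\notin\mathcal T$ the result is $\mathcal T\cup\{(\gamma,0)\}$; (b) if $(\gamma,0)\in\mathcal T$ and $(\gamma,1)\notin\mathcal T$ the slide terminates (without result); (c) if $(\gamma,0),(\gamma,1)\in\mathcal T$, continue with $P(\gamma+1,\gamma+1)$. (S2) Otherwise let $i\ge m$ be the smallest index with $(i,\gamma-1-i)\in\mathcal T$; then: (a) if $(i,\gamma-i)\notin\mathcal T$ the result is $\mathcal T\cup\{(i,\gamma-i)\}$; (b) if $(i,\gamma-i)\in\mathcal T$ and $(i,\gamma-i+1)\notin\mathcal T$ the slide terminates; (c) if $(i,\gamma-i),(i,\gamma-i+1)\in\mathcal T$, continue with $P(\gamma+1,i+1)$. -}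

module Defs where

open import Data.Nat using (ℕ; zero; suc; _+_; _≤_; _<_; _≡ᵇ_)
open import Data.Bool using (Bool; true; false; _∨_; _∧_; not)
open import Data.Product using (Σ; ∃; _×_; _,_)
open import Data.Sum using (_⊎_)
open import Data.List using (List; []; _∷_)
open import Data.List.Membership.Propositional using (_∈_)
open import Data.List.Relation.Unary.All using (All)
open import Relation.Binary.PropositionalEquality using (_≡_)

Cell : Set
Cell = ℕ × ℕ

Cells : Set
Cells = ℕ → ℕ → Bool

insert : Cell → Cells → Cells
insert (a , b) T i j = T i j ∨ ((i ≡ᵇ a) ∧ (j ≡ᵇ b))

remove : Cell → Cells → Cells
remove (a , b) T i j = T i j ∧ not ((i ≡ᵇ a) ∧ (j ≡ᵇ b))

record IsTowerDiagram (T : Cells) : Set where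
  field
    noColumnZero : ∀ j → T 0 j ≡ false
    downClosed   : ∀ i j k → k ≤ j → T i j ≡ true → T i k ≡ true
    finite       : ∃ λ N → ∀ i j → T i j ≡ true → (i < N × j < N)

-- Flight paths.  FlightPath T c P : the cell c has flight path P (listed as a list) in T.
-- The diagonal condition i' + j' = i + j - 1 is written i' + j' + 1 ≡ i + j.
data FlightPath (T : Cells) : Cell → List Cell → Set where
  f1 : ∀ {i j} → T i j ≡ true →
       (∀ i' j' → i' < i → i' + j' + 1 ≡ i + j → T i' j' ≡ false) →
       FlightPath T (i , j) ((i , j) ∷ [])
  f2 : ∀ {i j i' j' P} → T i j ≡ true →
       T i' j' ≡ true → i' < i → i' + j' + 1 ≡ i + j →
       (∀ k l → i' < k → k < i → k + l + 1 ≡ i + j → T k l ≡ false) →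
       T i' (suc j') ≡ true →
       FlightPath T (i' , j') P →
       FlightPath T (i , j) ((i , j) ∷ (i' , suc j') ∷ P)

HasFlightPath : Cells → Cell → Set
HasFlightPath T c = ∃ λ P → FlightPath T c P

_≤lex_ : Cell → Cell → Set
(a , b) ≤lex (c , d) = (a < c) ⊎ (a ≡ c × b ≤ d)

FlightNumber : Cells → Cell → ℕ → Set
FlightNumber T c n =
  Σ (List Cell) λ P → FlightPath T c P ×
    Σ ℕ λ a → Σ ℕ λ b → ((a , b) ∈ P) × All (λ x → (a , b) ≤lex x) P × (n ≡ a + b)

Corner : Cells → Cell → Set
Corner T (i , j) = T i j ≡ true × T i (suc j) ≡ false × HasFlightPath T (i , j)

-- Slide T γ m d : the procedure P(γ, m) run on T
-- does not terminate and its result is T ∪ {d}.  (The terminating cases S1b, S2b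
-- have no constructor.)  Diagonal x + y = γ - 1 is written i + j + 1 ≡ γ.
data Slide (T : Cells) : ℕ → ℕ → Cell → Set where
  s1a : ∀ {γ m} →
        (∀ i j → m ≤ i → i + j + 1 ≡ γ → T i j ≡ false) →
        T γ 0 ≡ false → Slide T γ m (γ , 0)
  s1c : ∀ {γ m d} →
        (∀ i j → m ≤ i → i + j + 1 ≡ γ → T i j ≡ false) →
        T γ 0 ≡ true → T γ 1 ≡ true →
        Slide T (suc γ) (suc γ) d → Slide T γ m d
  s2a : ∀ {γ m i j} →
        m ≤ i → i + j + 1 ≡ γ → T i j ≡ true →
        (∀ k l → m ≤ k → k < i → k + l + 1 ≡ γ → T k l ≡ false) →
        T i (suc j) ≡ false → Slide T γ m (i , suc j)
  s2c : ∀ {γ m i j d} →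
        m ≤ i → i + j + 1 ≡ γ → T i j ≡ true →
        (∀ k l → m ≤ k → k < i → k + l + 1 ≡ γ → T k l ≡ false) →
        T i (suc j) ≡ true → T i (suc (suc j)) ≡ true →
        Slide T (suc γ) (suc i) d → Slide T γ m d

-- A flight path runs from a cell down-left across consecutive diagonals, and its
-- lexicographically least cell is its base, the last cell reached; the flight number
-- is the diagonal of the base.  The slide α↘ retraces such a path upwards: at each
-- diagonal it looks for the first cell of the previous diagonal to the right of where
-- it last stood, exactly the cell that F2 links to.  So (a) the cell added by a slide
-- from α has a flight path based on diagonal α, built one step of the slide at a
-- time; and (b) sliding from the flight number of a corner c of T retraces the flight
-- path of c and puts c back, since the path only visits columns left of c.
module Submission where

open import Defs
open import Data.Nat using (ℕ; _≤_)
open import Data.Product using (Σ; _×_)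
open import Relation.Binary.PropositionalEquality using (_≡_)

open import Data.Bool using (true; false; _∧_)
open import Data.Bool.Properties using (∨-identityʳ; ∨-zeroʳ; ∧-identityʳ; ∧-zeroʳ; ¬-not; T-≡)
open import Data.List using (List)
open import Data.List.Membership.Propositional using (_∈_)
open import Data.List.Relation.Unary.All using (All; []; _∷_; lookup)
open import Data.List.Relation.Unary.Any using (here; there)
open import Data.Nat using (suc; _+_; _<_; _≡ᵇ_; z≤n; s≤s)
open import Data.Nat.Properties
open import Data.Product using (_,_; proj₁)
open import Data.Product.Properties using (≡-dec)
open import Data.Sum using (inj₁; inj₂)
open import Function using (_∘_)
open import Function.Bundles using (module Equivalence)
open import Relation.Binary.PropositionalEquality using (_≢_; refl; sym; trans; cong; subst)
open import Relation.Nullary using (yes; no; contradiction)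

private
  variable
    U : Cells
    a b i j k l γ m α n : ℕ
    c d : Cell
    P : List Cell

diagonal : Cell → ℕ
diagonal (i , j) = i + j

≡ᵇ-refl : ∀ n → (n ≡ᵇ n) ≡ true
≡ᵇ-refl n = Equivalence.to T-≡ (≡⇒≡ᵇ n n refl)

≢⇒≡ᵇ-false : i ≢ a → (i ≡ᵇ a) ≡ false
≢⇒≡ᵇ-false {i} {a} i≢a = ¬-not (i≢a ∘ ≡ᵇ⇒≡ i a ∘ Equivalence.from T-≡)

≢⇒matches-false : (i , j) ≢ (a , b) → ((i ≡ᵇ a) ∧ (j ≡ᵇ b)) ≡ false
≢⇒matches-false {i} {j} {a} {b} ne with i ≟ a
... | no i≢a rewrite ≢⇒≡ᵇ-false i≢a = refl
... | yes refl rewrite ≡ᵇ-refl i = ≢⇒≡ᵇ-false (ne ∘ cong (i ,_))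

insert-self : ∀ (U : Cells) → insert (a , b) U a b ≡ true
insert-self {a} {b} U rewrite ≡ᵇ-refl a | ≡ᵇ-refl b = ∨-zeroʳ (U a b)

insert-≢ : ∀ (U : Cells) → (i , j) ≢ (a , b) → insert (a , b) U i j ≡ U i j
insert-≢ {i} {j} U ne rewrite ≢⇒matches-false ne = ∨-identityʳ (U i j)

insert-mono : ∀ (U : Cells) d → U i j ≡ true → insert d U i j ≡ true
insert-mono U d present rewrite present = refl

remove-self : ∀ (U : Cells) → remove (a , b) U a b ≡ false
remove-self {a} {b} U rewrite ≡ᵇ-refl a | ≡ᵇ-refl b = ∧-zeroʳ (U a b)

remove-≢ : ∀ (U : Cells) → (i , j) ≢ (a , b) → remove (a , b) U i j ≡ U i j
remove-≢ {i} {j} U ne rewrite ≢⇒matches-false ne = ∧-identityʳ (U i j)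

remove-absent : ∀ (U : Cells) c → U i j ≡ false → remove c U i j ≡ false
remove-absent U c absent rewrite absent = refl

insert-remove : ∀ (U : Cells) → U a b ≡ true →
  ∀ i j → insert (a , b) (remove (a , b) U) i j ≡ U i j
insert-remove {a} {b} U present i j with ≡-dec _≟_ _≟_ (i , j) (a , b)
... | yes refl = trans (insert-self (remove (a , b) U)) (sym present)
... | no ne = trans (insert-≢ (remove (a , b) U) ne) (remove-≢ U ne)

column-positive : IsTowerDiagram U → U i j ≡ true → 1 ≤ i
column-positive {i = 0} {j} tower present =
  contradiction (trans (sym present) (IsTowerDiagram.noColumnZero tower j)) λ ()
column-positive {i = suc _} _ _ = s≤s z≤n

present-below : IsTowerDiagram U → U i (suc j) ≡ true → U i j ≡ true
present-below {j = j} tower = IsTowerDiagram.downClosed tower _ (suc j) j (n≤1+n j)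

absent-above : IsTowerDiagram U → U i j ≡ false → U i (suc j) ≡ false
absent-above {U} {i} {j} tower absent with U i (suc j) in above
... | false = refl
... | true = contradiction (trans (sym absent) (present-below tower above)) λ ()

+1≡+suc : ∀ i j → i + j + 1 ≡ i + suc j
+1≡+suc i j = trans (+-comm (i + j) 1) (sym (+-suc i j))

below⇒diagonal< : k + l + 1 ≡ γ → k + l < γ
below⇒diagonal< {k} {l} e = ≤-reflexive (trans (+-comm 1 (k + l)) e)

below⇒column< : k + l + 1 ≡ γ → k < γ
below⇒column< {k} {l} e = ≤-<-trans (m≤m+n k l) (below⇒diagonal< {k} {l} e)

insert-below : ∀ (U : Cells) d k l → k + l + 1 ≡ γ → γ ≤ diagonal d → insert d U k l ≡ U k l
insert-below U _ k l e γ≤d = insert-≢ U λ { refl → <⇒≱ (below⇒diagonal< {k} {l} e) γ≤d }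

Gap : Cells → ℕ → ℕ → ℕ → Set
Gap U γ m i = ∀ k l → m ≤ k → k < i → k + l + 1 ≡ γ → U k l ≡ false

slide-diagonal : Slide U γ m d → γ ≤ diagonal d
slide-diagonal {γ = γ} (s1a _ _) = m≤m+n γ 0
slide-diagonal (s1c _ _ _ rest) = <⇒≤ (slide-diagonal rest)
slide-diagonal (s2a {i = i} {j = j} _ e _ _ _) = ≤-reflexive (trans (sym e) (+1≡+suc i j))
slide-diagonal (s2c _ _ _ _ _ _ rest) = <⇒≤ (slide-diagonal rest)

≤lex-trans : c ≤lex d → d ≤lex (k , l) → c ≤lex (k , l)
≤lex-trans (inj₁ p) (inj₁ q) = inj₁ (<-trans p q)
≤lex-trans (inj₁ p) (inj₂ (refl , _)) = inj₁ p
≤lex-trans (inj₂ (refl , _)) (inj₁ q) = inj₁ q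
≤lex-trans (inj₂ (refl , p)) (inj₂ (refl , q)) = inj₂ (refl , ≤-trans p q)

≤lex-antisym : c ≤lex d → d ≤lex c → c ≡ d
≤lex-antisym (inj₁ p) (inj₁ q) = contradiction p (<-asym q)
≤lex-antisym (inj₁ p) (inj₂ (refl , _)) = contradiction p (n≮n _)
≤lex-antisym (inj₂ (refl , _)) (inj₁ q) = contradiction q (n≮n _)
≤lex-antisym (inj₂ (refl , p)) (inj₂ (_ , q)) = cong (_ ,_) (≤-antisym p q)

flightPath-cell : FlightPath U (i , j) P → U i j ≡ true
flightPath-cell (f1 present _) = present
flightPath-cell (f2 present _ _ _ _ _ _) = present

flightPath-head : FlightPath U c P → c ∈ P
flightPath-head (f1 _ _) = here refl
flightPath-head (f2 _ _ _ _ _ _ _) = here refl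

base : FlightPath U c P → Cell
base (f1 {i} {j} _ _) = (i , j)
base (f2 _ _ _ _ _ _ fp) = base fp

base∈ : (fp : FlightPath U c P) → base fp ∈ P
base∈ (f1 _ _) = here refl
base∈ (f2 _ _ _ _ _ _ fp) = there (there (base∈ fp))

base-least : (fp : FlightPath U c P) → All (base fp ≤lex_) P
base-least (f1 _ _) = inj₂ (refl , ≤-refl) ∷ []
base-least (f2 {j' = j'} _ _ i'<i _ _ _ fp) =
  ≤lex-trans base≤head (inj₁ i'<i) ∷
  ≤lex-trans base≤head (inj₂ (refl , n≤1+n j')) ∷
  base-least fp
  where base≤head = lookup (base-least fp) (flightPath-head fp)

FlightPathBasedOn : Cells → Cell → ℕ → Set
FlightPathBasedOn U c n = Σ (List Cell) λ P → Σ (FlightPath U c P) λ fp → diagonal (base fp) ≡ n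

based⇒flightNumber : FlightPathBasedOn U c n → FlightNumber U c n
based⇒flightNumber (P , fp , refl) =
  let (a , b) = base fp in P , fp , a , b , base∈ fp , base-least fp , refl

flightNumber⇒based : FlightNumber U c n → FlightPathBasedOn U c n
flightNumber⇒based (P , fp , a , b , least∈ , least , refl) =
  P , fp , cong diagonal (≤lex-antisym (lookup (base-least fp) least∈) (lookup least (base∈ fp)))

-- The invariant of the slide α↘ at the call P(γ, m): every cell of diagonal γ that the
-- procedure can reach next has flight number α.
Ahead : Cells → ℕ → ℕ → ℕ → Set
Ahead U α γ m = ∀ {i j} → i + j ≡ γ → m ≤ i → U i j ≡ true → Gap U γ m i →
  FlightPathBasedOn U (i , j) α

ahead-start : (∀ l → l + 1 ≡ α → U 0 l ≡ false) → Ahead U α α 1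
ahead-start {U = U} noColumnZero {i} {j} on 1≤i present gap = _ , f1 present nothingLeft , on
  where
  nothingLeft : ∀ k l → k < i → k + l + 1 ≡ i + j → U k l ≡ false
  nothingLeft 0 l _ e = noColumnZero l (trans e on)
  nothingLeft (suc k) l k<i e = gap (suc k) l (s≤s z≤n) k<i (trans e on)

ahead-step : i + j ≡ γ → U i (suc j) ≡ true → FlightPathBasedOn U (i , j) α →
  Ahead U α (suc γ) (suc i)
ahead-step {γ = γ} on above (_ , fp , based) {k} {l} on' i<k present gap =
  _ , f2 present (flightPath-cell fp) i<k diag (λ k' l' p q e → gap k' l' p q (trans e on')) above fp ,
  based
  where
  diag = trans (cong (_+ 1) on) (trans (+-comm γ 1) (sym on'))

module _ (T : Cells) (tower : IsTowerDiagram T) where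

  private
    lift : Slide T γ m d → Gap T γ m i → Gap (insert d T) γ m i
    lift {d = d} s gap k l p q e = trans (insert-below T d k l e (slide-diagonal s)) (gap k l p q e)

    landed : T a (suc b) ≡ false → FlightPathBasedOn (insert (a , b) T) (a , b) α →
      Corner (insert (a , b) T) (a , b) × FlightNumber (insert (a , b) T) (a , b) α
    landed {a} {b} above based@(P , fp , _) =
      (insert-self T , trans (insert-≢ {a} {suc b} {a} {b} T λ ()) above , P , fp) ,
      based⇒flightNumber based

  slide-from⇒corner : m ≤ γ → (s : Slide T γ m d) → Ahead (insert d T) α γ m →
    Corner (insert d T) d × FlightNumber (insert d T) d α
  slide-from⇒corner {γ = γ} m≤γ s@(s1a empty absent) ahead =
    landed (absent-above tower absent)
      (ahead (+-identityʳ γ) m≤γ (insert-self T) (lift s λ k l p _ → empty k l p))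
  slide-from⇒corner {γ = γ} {d} m≤γ s@(s1c empty present₀ present₁ rest) ahead =
    slide-from⇒corner ≤-refl rest (ahead-step (+-identityʳ γ) (insert-mono T d present₁)
      (ahead (+-identityʳ γ) m≤γ (insert-mono T d present₀) (lift s λ k l p _ → empty k l p)))
  slide-from⇒corner _ s@(s2a {i = i} {j} m≤i e _ gap absent) ahead =
    landed (absent-above tower absent)
      (ahead (trans (sym (+1≡+suc i j)) e) m≤i (insert-self T) (lift s gap))
  slide-from⇒corner {d = d} _ s@(s2c {i = i} {j} m≤i e _ gap present₁ present₂ rest) ahead =
    slide-from⇒corner (s≤s (<⇒≤ (below⇒column< e))) rest
      (ahead-step on (insert-mono T d present₂) (ahead on m≤i (insert-mono T d present₁) (lift s gap)))
    where on = trans (sym (+1≡+suc i j)) e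

  slide⇒corner : 1 ≤ α → Slide T α 1 d → Corner (insert d T) d × FlightNumber (insert d T) d α
  slide⇒corner {d = d} 1≤α s = slide-from⇒corner 1≤α s (ahead-start λ l e →
    trans (insert-below T d 0 l e (slide-diagonal s)) (IsTowerDiagram.noColumnZero tower l))

module _ (T : Cells) (tower : IsTowerDiagram T) where

  Restores : Cell → Cell → Set
  Restores c (i , j) = ∀ {m} → m ≤ i → Gap (remove c T) (i + j) m i → Slide (remove c T) (i + j) m c

  restores-self : T a b ≡ true → Restores (a , b) (a , b)
  restores-self {a} {0} _ {m} m≤a gap =
    subst (λ γ → Slide (remove (a , 0) T) γ m (a , 0)) (sym (+-identityʳ a))
      (s1a (λ k l p e → gap k l p (below⇒column< e) (trans e (sym (+-identityʳ a))))
           (remove-self T))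
  restores-self {a} {suc b} present m≤a gap =
    s2a m≤a (+1≡+suc a b) (trans (remove-≢ T λ ()) (present-below tower present)) gap (remove-self T)

  remove-column-≢ : i ≢ a → ∀ j → remove (a , b) T i j ≡ T i j
  remove-column-≢ i≢a _ = remove-≢ T (i≢a ∘ cong proj₁)

  restores-step : i ≢ a → T i j ≡ true → T i (suc j) ≡ true →
    Slide (remove (a , b) T) (suc (i + j)) (suc i) (a , b) → Restores (a , b) (i , j)
  restores-step {i} {a} {0} {b} i≢a present₀ present₁ next {m} m≤i gap =
    subst (λ γ → Slide (remove (a , b) T) γ m (a , b)) (sym (+-identityʳ i))
      (s1c (λ k l p e → gap k l p (below⇒column< e) (trans e (sym (+-identityʳ i))))
           (trans (remove-column-≢ {b = b} i≢a 0) present₀)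
           (trans (remove-column-≢ {b = b} i≢a 1) present₁)
           (subst (λ γ → Slide (remove (a , b) T) (suc γ) (suc i) (a , b)) (+-identityʳ i) next))
  restores-step {i} {a} {suc j} {b} i≢a present₁ present₂ next m≤i gap =
    s2c m≤i (+1≡+suc i j)
      (trans (remove-column-≢ {b = b} i≢a j) (present-below tower present₁)) gap
      (trans (remove-column-≢ {b = b} i≢a (suc j)) present₁)
      (trans (remove-column-≢ {b = b} i≢a (suc (suc j))) present₂) next

  restores-base : (fp : FlightPath T (i , j) P) → i ≤ a → Restores (a , b) (i , j) →
    Slide (remove (a , b) T) (diagonal (base fp)) 1 (a , b)
  restores-base {a = a} {b} (f1 present nothingLeft) _ restores =
    restores (column-positive tower present) λ k l _ k<i e →
      remove-absent T (a , b) (nothingLeft k l k<i e)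
  restores-base {a = a} {b} (f2 {i' = i'} {j'} _ present₀ i'<i e gap present₁ fp) i≤a restores =
    restores-base fp (<⇒≤ i'<a) (restores-step (<⇒≢ i'<a) present₀ present₁ next)
    where
    i'<a = <-≤-trans i'<i i≤a
    next = subst (λ γ → Slide (remove (a , b) T) γ (suc i') (a , b)) (sym (trans (+-comm 1 (i' + j')) e))
             (restores i'<i λ k l p q e → remove-absent T (a , b) (gap k l p q e))

  slide-restores-corner : T a b ≡ true → FlightPathBasedOn T (a , b) n →
    Slide (remove (a , b) T) n 1 (a , b)
  slide-restores-corner present (_ , fp , refl) = restores-base fp ≤-refl (restores-self present)

lemma3p3 : (T : Cells) → IsTowerDiagram T →
    ((α : ℕ) (d : Cell) → 1 ≤ α → Slide T α 1 d →
       Corner (insert d T) d × FlightNumber (insert d T) d α)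
    × ((c : Cell) (β : ℕ) → Corner T c → FlightNumber T c β →
       Σ Cell (λ d → Slide (remove c T) β 1 d × (∀ i j → insert d (remove c T) i j ≡ T i j)))
lemma3p3 T tower =
  (λ _ _ → slide⇒corner T tower) ,
  λ { (a , b) _ (present , _) flightNumber →
        (a , b) , slide-restores-corner T tower present (flightNumber⇒based flightNumber) ,
        insert-remove T present }
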